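{- Let $T$ be a complete binary tree with $n$ leaves and let $t$ be the binary tree formed by its internal nodes. The admissible labellings of $T$ are in bijection with the permutations of $\mathfrak S_{n-1}$ whose decreasing tree has shape $t$. In particular their number is $(n-1)!\prod_{v\in t}\frac1{h(v)}$, where $h(v)$ is the number of nodes of the subtree of $t$ rooted at $v$.
   Context: A labelling of $T$ is a bijective assignment of $1,\dots,n$ to the leaves (read left to right as a permutation $\sigma\in\mathfrak S_n$); it is admissible if at every internal node the smallest label among the leaves below it lies in its left subtree and the largest lies in its right subtree. The decreasing tree ${\rm DT}(w)$ of a word $w$ without repeated letters is empty if $w$ is empty, and otherwise, writing $w=u\,m\,v$ with $m=\max(w)$, is the binary tree with root labelled $m$, left subtree ${\rm DT}(u)$ and right subtree ${\rm DT}(v)$; its shape is the underlying unlabelled binary tree. -}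

module Defs where

open import Data.Bool using (Bool; true; false; _∧_; T)
open import Data.Nat using (ℕ; zero; suc; _+_; _*_; _⊔_; _⊓_; _≡ᵇ_; _≤ᵇ_)
open import Data.List using (List; []; _∷_; length; take; drop; takeWhile; foldr)
open import Data.Bool.ListAction using (all; any)
open import Data.Product using (Σ)
open import Relation.Nullary.Decidable using (¬?)
open import Data.Nat.Properties using (_≟_)

data FBT : Set where
  leaf : FBT
  node : FBT → FBT → FBT

leaves : FBT → ℕ
leaves leaf       = 1
leaves (node l r) = leaves l + leaves r

data BT : Set where
  empty : BT
  node  : BT → BT → BT

internal : FBT → BT
internal leaf       = empty
internal (node l r) = node (internal l) (internal r)

size : BT → ℕ
size empty      = 0
size (node l r) = suc (size l + size r)

hookProd : BT → ℕ
hookProd empty        = 1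
hookProd (node l r)   = size (node l r) * (hookProd l * hookProd r)

elemᵇ : ℕ → List ℕ → Bool
elemᵇ x xs = any (λ y → x ≡ᵇ y) xs

distinctᵇ : List ℕ → Bool
distinctᵇ []       = true
distinctᵇ (x ∷ xs) = (all (λ y → Data.Bool.not (x ≡ᵇ y)) xs) ∧ distinctᵇ xs

-- σ is (the one-line notation of) a permutation of {1,…,n}:
-- length n, entries in {1,…,n}, pairwise distinct.
isPermᵇ : ℕ → List ℕ → Bool
isPermᵇ n σ = (length σ ≡ᵇ n) ∧ (all (λ x → (1 ≤ᵇ x) ∧ (x ≤ᵇ n)) σ ∧ distinctᵇ σ)

-- minimum / maximum of a nonempty list (default value irrelevant for [])
minL : List ℕ → ℕ
minL []       = 0
minL (x ∷ xs) = foldr _⊓_ x xs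

maxL : List ℕ → ℕ
maxL []       = 0
maxL (x ∷ xs) = foldr _⊔_ x xs

-- A labelling of τ is a word σ (labels of the leaves read left to right).
admissibleᵇ : FBT → List ℕ → Bool
admissibleᵇ leaf       σ = true
admissibleᵇ (node l r) σ =
  elemᵇ (minL σ) (take (leaves l) σ) ∧
  (elemᵇ (maxL σ) (drop (leaves l) σ) ∧
  (admissibleᵇ l (take (leaves l) σ) ∧ admissibleᵇ r (drop (leaves l) σ)))

data LBT : Set where
  lempty : LBT
  lnode  : LBT → ℕ → LBT → LBT

shape : LBT → BT
shape lempty        = empty
shape (lnode l _ r) = node (shape l) (shape r)

-- Decreasing tree, with fuel (fuel = length suffices since u, v are shorter than w).
-- For w = u m v with m = max w: root m, left DT(u), right DT(v).
DTfuel : ℕ → List ℕ → LBT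
DTfuel zero    w        = lempty
DTfuel (suc f) []       = lempty
DTfuel (suc f) (x ∷ xs) =
  let w = x ∷ xs
      m = maxL w
      u = takeWhile (λ y → ¬? (y ≟ m)) w
      v = drop (suc (length u)) w
  in lnode (DTfuel f u) m (DTfuel f v)

DT : List ℕ → LBT
DT w = DTfuel (length w) w

AdmissibleLabelling : FBT → Set
AdmissibleLabelling τ = Σ (List ℕ) (λ σ → T (isPermᵇ (leaves τ) σ ∧ admissibleᵇ τ σ))

DTPerm : ℕ → BT → Set
DTPerm m t = Σ (List ℕ) (λ w → T (isPermᵇ m w) × shape (DT w) ≡ t)
  where
  open import Data.Product using (_×_)
  open import Relation.Binary.PropositionalEquality using (_≡_)

-- Both sets are in bijection with TreeShuffle t, which chooses at every node of t a shuffle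
-- of the sizes of its two subtrees; to make this recursive, labels range over an arbitrary
-- increasing list S instead of 1, …, n.
-- An admissible labelling of node l r with labels h < M < z must put h into the left block and
-- z into the right one, so it amounts to the choice of the labels of M that go left (a shuffle
-- of size (internal l) and size (internal r)) and admissible labellings of l and r by the two
-- parts. A word on M and its maximum z is u z v, and shape (DT (u z v)) is node (DT u) (DT v),
-- so it amounts to the choice of the letters of M in u and two words of the right shapes.
-- There are (a + b)! / (a! b!) shuffles of a and b letters, and over the nodes of t these
-- factors telescope to (size t)! / ∏ h(v).

module Submission where

open import Defs
open import Data.Bool using (Bool; true; false; T; not; _∧_)
open import Data.Bool.Properties using (T-∧; T-≡; T-not-≡; T-irrelevant; ¬-not)
open import Data.Bool.ListAction using (all; and)
open import Data.Nat using (ℕ; zero; suc; _+_; _*_; _∸_; _!; _≤_; _<_; z≤n; s≤s; _≡ᵇ_; _≤ᵇ_; _⊓_; _⊔_)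
open import Data.Nat.Properties
open import Data.Nat.Tactic.RingSolver using (solve-∀)
open import Data.List using (List; []; _∷_; [_]; _++_; _∷ʳ_; length; take; drop; takeWhile; map; applyUpTo; foldr; initLast; _∷ʳ′_)
open import Data.List.Properties using (length-++; length-map; length-take; length-drop; take++drop≡id; length-removeAt′; length-applyUpTo; map-cong; foldr-preservesᵇ; foldr-preservesᵒ)
open import Data.List.Membership.Propositional using (_∈_; _∉_)
open import Data.List.Membership.Propositional.Properties using (∈-++⁺ˡ; ∈-++⁺ʳ; ∈-++⁻; ∈-applyUpTo⁺; ∈-applyUpTo⁻)
open import Data.List.Membership.DecPropositional _≟_ using (_∈?_)
open import Data.List.Relation.Unary.Any as Any using (Any; here; there; _─_)
open import Data.List.Relation.Unary.Any.Properties using (any⁺; any⁻)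
open import Data.List.Relation.Unary.All as All using (All; []; _∷_)
import Data.List.Relation.Unary.All.Properties as Allₚ
open import Data.List.Relation.Unary.AllPairs as AllPairs using (AllPairs; []; _∷_)
import Data.List.Relation.Unary.AllPairs.Properties as AllPairsₚ
open import Data.List.Relation.Unary.Unique.Propositional using (Unique)
import Data.List.Relation.Unary.Unique.Propositional.Properties as Uniqueₚ
open import Data.List.Relation.Binary.Subset.Propositional using (_⊆_)
open import Data.List.Relation.Binary.Disjoint.Propositional using (Disjoint)
open import Data.Product using (Σ; _×_; _,_; proj₁; proj₂)
open import Data.Sum using (_⊎_; inj₁; inj₂)
open import Data.Empty using (⊥-elim)
open import Function.Base using (_∘_)
open import Function.Bundles using (Equivalence; _⇔_; mk⇔; _↔_; mk↔ₛ′)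
open import Function.Properties.Inverse using (↔-refl; ↔-trans; ↔-sym)
open import Data.Product.Function.Dependent.Propositional using (Σ-↔)
open import Data.Product.Function.NonDependent.Propositional using (_×-↔_)
open import Data.Unit using (⊤; tt)
open import Data.Fin using (Fin)
open import Data.Fin.Properties using (1↔⊤; +↔⊎; *↔×)
open import Data.Sum.Function.Propositional using (_⊎-↔_)
open import Relation.Binary.Core using (Rel)
open import Relation.Binary.PropositionalEquality hiding ([_])
open import Relation.Nullary using (yes; no; contradiction)
open import Relation.Nullary.Decidable using (¬?)
open import Relation.Nullary.Irrelevant using (Irrelevant)
open import Relation.Binary.Definitions using (DecidableEquality)
open import Axiom.UniquenessOfIdentityProofs using (module Decidable⇒UIP)

private variable
  A : Set
  R : Rel A _
  x y : A
  xs ys σ : List A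

T-injective : ∀ {x y} → T x ⇔ T y → x ≡ y
T-injective {false} {false} _ = refl
T-injective {false} {true}  x⇔y = ⊥-elim (Equivalence.from x⇔y tt)
T-injective {true}  {false} x⇔y = ⊥-elim (Equivalence.to x⇔y tt)
T-injective {true}  {true}  _ = refl

Σ-≡-irrelevant : {B : A → Set} → (∀ {x} → Irrelevant (B x)) → {p q : Σ A B} → proj₁ p ≡ proj₁ q → p ≡ q
Σ-≡-irrelevant B-irr {x , p} {.x , q} refl = cong (x ,_) (B-irr p q)

×-irrelevant : {B C : Set} → Irrelevant B → Irrelevant C → Irrelevant (B × C)
×-irrelevant B-irr C-irr (b , c) (b′ , c′) = cong₂ _,_ (B-irr b b′) (C-irr c c′)

⇔⇒↔-irrelevant : {B C : Set} → Irrelevant B → Irrelevant C → B ⇔ C → B ↔ C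
⇔⇒↔-irrelevant B-irr C-irr B⇔C =
  mk↔ₛ′ (Equivalence.to B⇔C) (Equivalence.from B⇔C) (λ _ → C-irr _ _) (λ _ → B-irr _ _)

+≡+-≤⇒≡ : ∀ {a b c d} → a ≤ c → b ≤ d → a + b ≡ c + d → a ≡ c × b ≡ d
+≡+-≤⇒≡ {a} {b} {c} {d} a≤c b≤d a+b≡c+d =
  ≤-antisym a≤c (+-cancelʳ-≤ d c a (≤-trans (≤-reflexive (sym a+b≡c+d)) (+-monoʳ-≤ a b≤d))) ,
  ≤-antisym b≤d (+-cancelˡ-≤ c d b (≤-trans (≤-reflexive (sym a+b≡c+d)) (+-monoˡ-≤ b a≤c)))

length-∷ʳ : ∀ (xs : List A) x → length (xs ∷ʳ x) ≡ suc (length xs)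
length-∷ʳ xs x = trans (length-++ xs) (+-comm _ 1)

length-take-+ : ∀ m {n} (xs : List A) → length xs ≡ m + n → length (take m xs) ≡ m
length-take-+ m xs xs≡m+n = trans (length-take m xs) (trans (cong (m ⊓_) xs≡m+n) (m≤n⇒m⊓n≡m (m≤m+n m _)))

length-drop-+ : ∀ m {n} (xs : List A) → length xs ≡ m + n → length (drop m xs) ≡ n
length-drop-+ m xs xs≡m+n = trans (length-drop m xs) (trans (cong (_∸ m) xs≡m+n) (m+n∸m≡n m _))

take-length-++ : ∀ m (xs ys : List A) → length xs ≡ m → take m (xs ++ ys) ≡ xs
take-length-++ _ [] ys refl = refl
take-length-++ _ (x ∷ xs) ys refl = cong (x ∷_) (take-length-++ _ xs ys refl)

drop-length-++ : ∀ m (xs ys : List A) → length xs ≡ m → drop m (xs ++ ys) ≡ ys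
drop-length-++ _ [] ys refl = refl
drop-length-++ _ (x ∷ xs) ys refl = drop-length-++ _ xs ys refl

drop-suc-length : ∀ (u : List A) x v → drop (suc (length u)) (u ++ x ∷ v) ≡ v
drop-suc-length [] x v = refl
drop-suc-length (y ∷ u) x v = drop-suc-length u x v

T-not-≡ᵇ⇔≢ : ∀ {m n} → T (not (m ≡ᵇ n)) ⇔ m ≢ n
T-not-≡ᵇ⇔≢ {m} {n} = mk⇔
  (λ p m≡n → subst T (Equivalence.to T-not-≡ p) (≡⇒≡ᵇ m n m≡n))
  (λ m≢n → Equivalence.from T-not-≡ (¬-not (λ e → m≢n (≡ᵇ⇒≡ m n (Equivalence.from T-≡ e)))))

T-elemᵇ⇔∈ : ∀ {n ns} → T (elemᵇ n ns) ⇔ n ∈ ns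
T-elemᵇ⇔∈ {n} {ns} = mk⇔
  (λ p → Any.map (≡ᵇ⇒≡ n _) (any⁻ _ ns p))
  (λ n∈ns → any⁺ _ (Any.map (λ { refl → ≡⇒≡ᵇ n n refl }) n∈ns))

T-distinctᵇ⇔Unique : ∀ {ns} → T (distinctᵇ ns) ⇔ Unique ns
T-distinctᵇ⇔Unique = mk⇔ to from
  where
  to : ∀ {ns} → T (distinctᵇ ns) → Unique ns
  to {[]} _ = []
  to {n ∷ ns} p with Equivalence.to T-∧ p
  ... | n∉ns , ns-distinct = All.map (Equivalence.to T-not-≡ᵇ⇔≢) (Allₚ.all⁺ _ ns n∉ns) ∷ to ns-distinct
  from : ∀ {ns} → Unique ns → T (distinctᵇ ns)
  from [] = _
  from (n∉ns ∷ ns-unique) =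
    Equivalence.from T-∧ (Allₚ.all⁻ _ (All.map (Equivalence.from T-not-≡ᵇ⇔≢) n∉ns) , from ns-unique)

AllPairs-++⁻ : ∀ xs → AllPairs R (xs ++ ys) →
               AllPairs R xs × AllPairs R ys × All (λ x → All (R x) ys) xs
AllPairs-++⁻ [] Rys = [] , Rys , []
AllPairs-++⁻ (x ∷ xs) (Rxxsys ∷ Rxsys) with AllPairs-++⁻ xs Rxsys
... | Rxs , Rys , Rxsys-cross = Allₚ.++⁻ˡ xs Rxxsys ∷ Rxs , Rys , Allₚ.++⁻ʳ xs Rxxsys ∷ Rxsys-cross

All≢⇒∉ : All (x ≢_) xs → x ∉ xs
All≢⇒∉ = Allₚ.All¬⇒¬Any

Unique-++⁻ : ∀ xs → Unique (xs ++ ys) → Unique xs × Unique ys × Disjoint xs ys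
Unique-++⁻ xs u with AllPairs-++⁻ xs u
... | xs-unique , ys-unique , cross =
  xs-unique , ys-unique , λ (v∈xs , v∈ys) → All≢⇒∉ (All.lookup cross v∈xs) v∈ys

∈-─ : (y∈ys : y ∈ ys) → x ∈ ys → x ≢ y → x ∈ (ys ─ y∈ys)
∈-─ (here refl) (here refl) x≢y = contradiction refl x≢y
∈-─ (here refl) (there x∈ys) _  = x∈ys
∈-─ (there _)   (here refl)  _  = here refl
∈-─ (there y∈ys) (there x∈ys) x≢y = there (∈-─ y∈ys x∈ys x≢y)

⊆-─ : (y∈ys : y ∈ ys) → xs ⊆ ys → y ∉ xs → xs ⊆ (ys ─ y∈ys)
⊆-─ y∈ys xs⊆ys y∉xs x∈xs = ∈-─ y∈ys (xs⊆ys x∈xs) (λ { refl → y∉xs x∈xs })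

length-─ : (y∈ys : y ∈ ys) → length ys ≡ suc (length (ys ─ y∈ys))
length-─ {ys = ys} y∈ys = length-removeAt′ ys (Any.index y∈ys)

Unique-⊆⇒length≤ : Unique xs → xs ⊆ ys → length xs ≤ length ys
Unique-⊆⇒length≤ [] _ = z≤n
Unique-⊆⇒length≤ (x∉xs ∷ xs-unique) x∷xs⊆ys =
  subst (_ ≤_) (sym (length-─ x∈ys))
    (s≤s (Unique-⊆⇒length≤ xs-unique (⊆-─ x∈ys (λ x∈xs → x∷xs⊆ys (there x∈xs)) (All≢⇒∉ x∉xs))))
  where x∈ys = x∷xs⊆ys (here refl)

Unique-⊆-length≤⇒⊇ : {xs ys : List ℕ} → Unique xs → xs ⊆ ys → length ys ≤ length xs → ys ⊆ xs
Unique-⊆-length≤⇒⊇ {xs = xs} {ys = ys} xs-unique xs⊆ys ys≤xs {y} y∈ys with y ∈? xs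
... | yes y∈xs = y∈xs
... | no y∉xs = contradiction ys≤xs (<⇒≱ (subst (_ <_) (sym (length-─ y∈ys))
                  (s≤s (Unique-⊆⇒length≤ xs-unique (⊆-─ y∈ys xs⊆ys y∉xs)))))

PermutationOf : List A → List A → Set _
PermutationOf S σ = length σ ≡ length S × σ ⊆ S × Unique σ

permutationOfᵇ : List ℕ → List ℕ → Bool
permutationOfᵇ S σ = (length σ ≡ᵇ length S) ∧ (all (λ n → elemᵇ n S) σ ∧ distinctᵇ σ)

T-permutationOfᵇ⇔ : ∀ {S σ} → T (permutationOfᵇ S σ) ⇔ PermutationOf S σ
T-permutationOfᵇ⇔ {S} {σ} = mk⇔ to from
  where
  to : T (permutationOfᵇ S σ) → PermutationOf S σ
  to p with Equivalence.to T-∧ p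
  ... | same-length , rest with Equivalence.to T-∧ rest
  ... | all-in , distinct =
    ≡ᵇ⇒≡ _ _ same-length ,
    (λ n∈σ → Equivalence.to T-elemᵇ⇔∈ (All.lookup (Allₚ.all⁺ _ σ all-in) n∈σ)) ,
    Equivalence.to T-distinctᵇ⇔Unique distinct
  from : PermutationOf S σ → T (permutationOfᵇ S σ)
  from (same-length , σ⊆S , σ-unique) = Equivalence.from T-∧ (≡⇒≡ᵇ _ _ same-length ,
    Equivalence.from T-∧ (Allₚ.all⁻ _ (All.tabulate (λ n∈σ → Equivalence.from T-elemᵇ⇔∈ (σ⊆S n∈σ))) ,
                          Equivalence.from T-distinctᵇ⇔Unique σ-unique))

PermutationOf⇒⊇ : {xs σ : List ℕ} → PermutationOf xs σ → xs ⊆ σ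
PermutationOf⇒⊇ (same-length , σ⊆xs , σ-unique) = Unique-⊆-length≤⇒⊇ σ-unique σ⊆xs (≤-reflexive (sym same-length))

PermutationOf-[] : PermutationOf [] σ → σ ≡ []
PermutationOf-[] {σ = []} _ = refl

PermutationOf-singleton : PermutationOf [ x ] σ → σ ≡ [ x ]
PermutationOf-singleton {σ = y ∷ []} (_ , σ⊆ , _) with σ⊆ (here refl)
... | here refl = refl

PermutationOf-∷ʳ-∷⁻ : ∀ {S : List A} {x xs} → PermutationOf (S ∷ʳ x) (x ∷ xs) → PermutationOf S xs
PermutationOf-∷ʳ-∷⁻ {S = S} {x} (x∷xs≡ , x∷xs⊆ , x∉xs ∷ xs-unique) =
  suc-injective (trans x∷xs≡ (length-∷ʳ S x)) , xs⊆S , xs-unique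
  where
  xs⊆S : _ ⊆ S
  xs⊆S y∈xs with ∈-++⁻ S (x∷xs⊆ (there y∈xs))
  ... | inj₁ y∈S = y∈S
  ... | inj₂ (here refl) = contradiction y∈xs (All≢⇒∉ x∉xs)

PermutationOf-∷ʳ-∷⁺ : ∀ {S : List A} {x xs} → x ∉ S → PermutationOf S xs → PermutationOf (S ∷ʳ x) (x ∷ xs)
PermutationOf-∷ʳ-∷⁺ {S = S} {x} x∉S (xs≡S , xs⊆S , xs-unique) =
  trans (cong suc xs≡S) (sym (length-∷ʳ S x)) , x∷xs⊆ ,
  Allₚ.¬Any⇒All¬ _ (λ x∈xs → x∉S (xs⊆S x∈xs)) ∷ xs-unique
  where
  x∷xs⊆ : x ∷ _ ⊆ S ∷ʳ x
  x∷xs⊆ (here refl) = ∈-++⁺ʳ S (here refl)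
  x∷xs⊆ (there y∈xs) = ∈-++⁺ˡ (xs⊆S y∈xs)

minL-≡ : ∀ {ns m} → m ∈ ns → All (m ≤_) ns → minL ns ≡ m
minL-≡ {n ∷ ns} {m} m∈ns m≤ns =
  ≤-antisym (foldr-preservesᵒ ⊓-≤ n ns (∈⇒≤ m∈ns)) (foldr-preservesᵇ ⊓-glb (All.head m≤ns) (All.tail m≤ns))
  where
  ⊓-≤ : ∀ a b → a ≤ m ⊎ b ≤ m → a ⊓ b ≤ m
  ⊓-≤ a b (inj₁ a≤m) = m≤n⇒m⊓o≤n b a≤m
  ⊓-≤ a b (inj₂ b≤m) = m≤n⇒o⊓m≤n a b≤m
  ∈⇒≤ : ∀ {n ns} → m ∈ n ∷ ns → n ≤ m ⊎ Any (_≤ m) ns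
  ∈⇒≤ (here refl) = inj₁ ≤-refl
  ∈⇒≤ (there m∈ns) = inj₂ (Any.map (λ { refl → ≤-refl }) m∈ns)

maxL-≡ : ∀ {ns m} → m ∈ ns → All (_≤ m) ns → maxL ns ≡ m
maxL-≡ {n ∷ ns} {m} m∈ns ns≤m =
  ≤-antisym (foldr-preservesᵇ ⊔-lub (All.head ns≤m) (All.tail ns≤m)) (foldr-preservesᵒ ≤-⊔ n ns (∈⇒≥ m∈ns))
  where
  ≤-⊔ : ∀ a b → m ≤ a ⊎ m ≤ b → m ≤ a ⊔ b
  ≤-⊔ a b (inj₁ m≤a) = m≤n⇒m≤n⊔o b m≤a
  ≤-⊔ a b (inj₂ m≤b) = m≤n⇒m≤o⊔n a m≤b
  ∈⇒≥ : ∀ {n ns} → m ∈ n ∷ ns → m ≤ n ⊎ Any (m ≤_) ns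
  ∈⇒≥ (here refl) = inj₁ ≤-refl
  ∈⇒≥ (there m∈ns) = inj₂ (Any.map (λ { refl → ≤-refl }) m∈ns)

maxL-∈ : ∀ n ns → maxL (n ∷ ns) ∈ n ∷ ns
maxL-∈ n ns = foldr-preservesᵇ ⊔-∈ (here refl) (All.tabulate there)
  where
  ⊔-∈ : ∀ {a b} → a ∈ n ∷ ns → b ∈ n ∷ ns → a ⊔ b ∈ n ∷ ns
  ⊔-∈ {a} {b} a∈ b∈ with ⊔-sel a b
  ... | inj₁ a⊔b≡a = subst (_∈ n ∷ ns) (sym a⊔b≡a) a∈
  ... | inj₂ a⊔b≡b = subst (_∈ n ∷ ns) (sym a⊔b≡b) b∈

minL-PermutationOf : ∀ {S σ m} → PermutationOf S σ → m ∈ S → All (m ≤_) S → minL σ ≡ m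
minL-PermutationOf σ↭S@(_ , σ⊆S , _) m∈S m≤S =
  minL-≡ (PermutationOf⇒⊇ σ↭S m∈S) (All.tabulate (λ n∈σ → All.lookup m≤S (σ⊆S n∈σ)))

maxL-PermutationOf : ∀ {S σ m} → PermutationOf S σ → m ∈ S → All (_≤ m) S → maxL σ ≡ m
maxL-PermutationOf σ↭S@(_ , σ⊆S , _) m∈S S≤m =
  maxL-≡ (PermutationOf⇒⊇ σ↭S m∈S) (All.tabulate (λ n∈σ → All.lookup S≤m (σ⊆S n∈σ)))

Increasing : List ℕ → Set
Increasing = AllPairs _<_

Increasing⇒Unique : ∀ {ns} → Increasing ns → Unique ns
Increasing⇒Unique = AllPairs.map <⇒≢

Increasing-∷ʳ⁻ : ∀ {ns m} → Increasing (ns ∷ʳ m) → Increasing ns × All (_< m) ns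
Increasing-∷ʳ⁻ {ns} inc with AllPairs-++⁻ ns inc
... | ns-inc , _ , ns<m = ns-inc , All.map All.head ns<m

Increasing-∷ʳ⁺ : ∀ {ns m} → Increasing ns → All (_< m) ns → Increasing (ns ∷ʳ m)
Increasing-∷ʳ⁺ ns-inc ns<m = AllPairsₚ.++⁺ ns-inc ([] ∷ []) (All.map (_∷ []) ns<m)

Increasing⇒head≤ : ∀ {m ns} → Increasing (m ∷ ns) → All (m ≤_) (m ∷ ns)
Increasing⇒head≤ (m<ns ∷ _) = ≤-refl ∷ All.map <⇒≤ m<ns

Increasing⇒≤last : ∀ {m ns} → Increasing (ns ∷ʳ m) → All (_≤ m) (ns ∷ʳ m)
Increasing⇒≤last inc = Allₚ.++⁺ (All.map <⇒≤ (proj₂ (Increasing-∷ʳ⁻ inc))) (≤-refl ∷ [])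

-- Sublists selected by a Boolean mask

select : List Bool → List A → List A
select _            []       = []
select []           (x ∷ xs) = []
select (true ∷ bs)  (x ∷ xs) = x ∷ select bs xs
select (false ∷ bs) (x ∷ xs) = select bs xs

selectᶜ : List Bool → List A → List A
selectᶜ bs = select (map not bs)

trues : List Bool → ℕ
trues []           = 0
trues (true ∷ bs)  = suc (trues bs)
trues (false ∷ bs) = trues bs

falses : List Bool → ℕ
falses bs = trues (map not bs)

trues+falses : ∀ bs → trues bs + falses bs ≡ length bs
trues+falses []           = refl
trues+falses (true ∷ bs)  = cong suc (trues+falses bs)
trues+falses (false ∷ bs) = trans (+-suc _ _) (cong suc (trues+falses bs))

select-⊆ : ∀ bs (xs : List A) → select bs xs ⊆ xs
select-⊆ (true ∷ bs)  (x ∷ xs) (here refl) = here refl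
select-⊆ (true ∷ bs)  (x ∷ xs) (there y∈) = there (select-⊆ bs xs y∈)
select-⊆ (false ∷ bs) (x ∷ xs) y∈ = there (select-⊆ bs xs y∈)

length-select : ∀ bs (xs : List A) → length bs ≡ length xs → length (select bs xs) ≡ trues bs
length-select []           []       _ = refl
length-select (true ∷ bs)  (x ∷ xs) e = cong suc (length-select bs xs (suc-injective e))
length-select (false ∷ bs) (x ∷ xs) e = length-select bs xs (suc-injective e)

length-selectᶜ : ∀ bs (xs : List A) → length bs ≡ length xs → length (selectᶜ bs xs) ≡ falses bs
length-selectᶜ bs xs e = length-select (map not bs) xs (trans (length-map not bs) e)

select-lengths⇒counts : ∀ {a b} bs (xs : List A) → length bs ≡ length xs →
  length (select bs xs) ≡ a → length (selectᶜ bs xs) ≡ b → trues bs ≡ a × falses bs ≡ b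
select-lengths⇒counts bs xs bs≡xs select≡a selectᶜ≡b =
  trans (sym (length-select bs xs bs≡xs)) select≡a , trans (sym (length-selectᶜ bs xs bs≡xs)) selectᶜ≡b

AllPairs-select : ∀ bs → AllPairs R xs → AllPairs R (select bs xs)
AllPairs-select {xs = []} bs _ = []
AllPairs-select {xs = x ∷ xs} [] _ = []
AllPairs-select {xs = x ∷ xs} (true ∷ bs) (Rx ∷ Rxs) =
  All.tabulate (λ y∈ → All.lookup Rx (select-⊆ bs xs y∈)) ∷ AllPairs-select bs Rxs
AllPairs-select {xs = x ∷ xs} (false ∷ bs) (_ ∷ Rxs) = AllPairs-select bs Rxs

Increasing-select-∷ʳ : ∀ bs {M z} → Increasing (M ∷ʳ z) → Increasing (select bs M ∷ʳ z)
Increasing-select-∷ʳ bs {M} inc with Increasing-∷ʳ⁻ inc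
... | M-inc , M<z = Increasing-∷ʳ⁺ (AllPairs-select bs M-inc) (All.tabulate (λ n∈ → All.lookup M<z (select-⊆ bs M n∈)))

select-selectᶜ-disjoint : ∀ bs → Unique xs → Disjoint (select bs xs) (selectᶜ bs xs)
select-selectᶜ-disjoint {xs = x ∷ xs} (true ∷ bs) (x∉xs ∷ _) (here refl , x∈) =
  All≢⇒∉ x∉xs (select-⊆ (map not bs) xs x∈)
select-selectᶜ-disjoint {xs = x ∷ xs} (true ∷ bs) (_ ∷ xs-unique) (there y∈ , y∈ᶜ) =
  select-selectᶜ-disjoint bs xs-unique (y∈ , y∈ᶜ)
select-selectᶜ-disjoint {xs = x ∷ xs} (false ∷ bs) (x∉xs ∷ _) (x∈ , here refl) =
  All≢⇒∉ x∉xs (select-⊆ bs xs x∈)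
select-selectᶜ-disjoint {xs = x ∷ xs} (false ∷ bs) (_ ∷ xs-unique) (y∈ , there y∈ᶜ) =
  select-selectᶜ-disjoint bs xs-unique (y∈ , y∈ᶜ)

mask : List ℕ → List ℕ → List Bool
mask α = map (λ n → elemᵇ n α)

∈-select-mask : ∀ {n α} M → n ∈ M → n ∈ α → n ∈ select (mask α M) M
∈-select-mask {α = α} (m ∷ M) n∈M n∈α with elemᵇ m α in m∈?α
∈-select-mask (m ∷ M) (here refl) n∈α | true  = here refl
∈-select-mask (m ∷ M) (there n∈M) n∈α | true  = there (∈-select-mask M n∈M n∈α)
∈-select-mask (m ∷ M) (here refl) n∈α | false = contradiction (Equivalence.from T-elemᵇ⇔∈ n∈α) (λ t → subst T m∈?α t)
∈-select-mask (m ∷ M) (there n∈M) n∈α | false = ∈-select-mask M n∈M n∈α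

∈-selectᶜ-mask : ∀ {n α} M → n ∈ M → n ∉ α → n ∈ selectᶜ (mask α M) M
∈-selectᶜ-mask {α = α} (m ∷ M) n∈M n∉α with elemᵇ m α in m∈?α
∈-selectᶜ-mask (m ∷ M) (here refl) n∉α | true  = contradiction (Equivalence.to T-elemᵇ⇔∈ (subst T (sym m∈?α) _)) n∉α
∈-selectᶜ-mask (m ∷ M) (there n∈M) n∉α | true  = ∈-selectᶜ-mask M n∈M n∉α
∈-selectᶜ-mask (m ∷ M) (here refl) n∉α | false = here refl
∈-selectᶜ-mask (m ∷ M) (there n∈M) n∉α | false = there (∈-selectᶜ-mask M n∈M n∉α)

mask-select : ∀ {α} bs M → length bs ≡ length M → select bs M ⊆ α → Disjoint (selectᶜ bs M) α → mask α M ≡ bs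
mask-select [] [] _ _ _ = refl
mask-select {α} (true ∷ bs) (m ∷ M) e sel⊆α selᶜ∩α =
  cong₂ _∷_ (Equivalence.to T-≡ (Equivalence.from T-elemᵇ⇔∈ (sel⊆α (here refl))))
            (mask-select bs M (suc-injective e) (λ n∈ → sel⊆α (there n∈)) selᶜ∩α)
mask-select {α} (false ∷ bs) (m ∷ M) e sel⊆α selᶜ∩α =
  cong₂ _∷_ (¬-not (λ e → selᶜ∩α (here refl , Equivalence.to T-elemᵇ⇔∈ (Equivalence.from T-≡ e))))
            (mask-select bs M (suc-injective e) sel⊆α (λ (n∈ , n∈α) → selᶜ∩α (there n∈ , n∈α)))

length-select-++ : ∀ X bs M (Y : List A) → length bs ≡ length M →
  length (X ++ select bs M) + length (selectᶜ bs M ++ Y) ≡ length (X ++ M ++ Y)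
length-select-++ X bs M Y bs≡M = begin
  length (X ++ select bs M) + length (selectᶜ bs M ++ Y)
    ≡⟨ cong₂ _+_ (length-++ X) (length-++ (selectᶜ bs M)) ⟩
  (length X + length (select bs M)) + (length (selectᶜ bs M) + length Y)
    ≡⟨ cong₂ (λ s sᶜ → (length X + s) + (sᶜ + length Y)) (length-select bs M bs≡M) (length-selectᶜ bs M bs≡M) ⟩
  (length X + trues bs) + (falses bs + length Y)
    ≡⟨ +-assoc (length X) (trues bs) _ ⟩
  length X + (trues bs + (falses bs + length Y))
    ≡⟨ cong (length X +_) (sym (+-assoc (trues bs) (falses bs) (length Y))) ⟩
  length X + ((trues bs + falses bs) + length Y)
    ≡⟨ cong (λ k → length X + (k + length Y)) (trans (trues+falses bs) bs≡M) ⟩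
  length X + (length M + length Y)
    ≡⟨ trans (cong (length X +_) (sym (length-++ M))) (sym (length-++ X)) ⟩
  length (X ++ M ++ Y) ∎
  where open ≡-Reasoning

select-++-disjoint : ∀ {X M Y : List A} bs → Unique (X ++ M ++ Y) → Disjoint (X ++ select bs M) (selectᶜ bs M ++ Y)
select-++-disjoint {X = X} {M = M} {Y = Y} bs XMY-unique (n∈ , n∈ᶜ)
  with Unique-++⁻ X XMY-unique
... | _ , MY-unique , X∩MY with Unique-++⁻ M MY-unique | ∈-++⁻ X n∈ | ∈-++⁻ (selectᶜ bs M) n∈ᶜ
... | _ , _ , _        | inj₁ n∈X | inj₁ n∈Mᶜ = X∩MY (n∈X , ∈-++⁺ˡ (select-⊆ (map not bs) M n∈Mᶜ))
... | _ , _ , _        | inj₁ n∈X | inj₂ n∈Y  = X∩MY (n∈X , ∈-++⁺ʳ M n∈Y)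
... | M-unique , _ , _ | inj₂ n∈M | inj₁ n∈Mᶜ = select-selectᶜ-disjoint {xs = M} bs M-unique (n∈M , n∈Mᶜ)
... | _ , _ , M∩Y      | inj₂ n∈M | inj₂ n∈Y  = M∩Y (select-⊆ bs M n∈M , n∈Y)

PermutationOf-split : ∀ {X M Y α β} → PermutationOf (X ++ M ++ Y) (α ++ β) → X ⊆ α → Y ⊆ β →
  PermutationOf (X ++ select (mask α M) M) α × PermutationOf (selectᶜ (mask α M) M ++ Y) β
PermutationOf-split {X} {M} {Y} {α} {β} (αβ≡XMY , αβ⊆XMY , αβ-unique) X⊆α Y⊆β
  with Unique-++⁻ α αβ-unique
... | α-unique , β-unique , α∩β = (proj₁ lengths , α⊆ , α-unique) , (proj₂ lengths , β⊆ , β-unique)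
  where
  bs = mask α M
  α⊆ : α ⊆ X ++ select bs M
  α⊆ n∈α with ∈-++⁻ X (αβ⊆XMY (∈-++⁺ˡ n∈α))
  ... | inj₁ n∈X = ∈-++⁺ˡ n∈X
  ... | inj₂ n∈MY with ∈-++⁻ M n∈MY
  ...   | inj₁ n∈M = ∈-++⁺ʳ X (∈-select-mask M n∈M n∈α)
  ...   | inj₂ n∈Y = contradiction (n∈α , Y⊆β n∈Y) α∩β
  β⊆ : β ⊆ selectᶜ bs M ++ Y
  β⊆ n∈β with ∈-++⁻ X (αβ⊆XMY (∈-++⁺ʳ α n∈β))
  ... | inj₁ n∈X = contradiction (X⊆α n∈X , n∈β) α∩β
  ... | inj₂ n∈MY with ∈-++⁻ M n∈MY
  ...   | inj₁ n∈M = ∈-++⁺ˡ (∈-selectᶜ-mask M n∈M (λ n∈α → α∩β (n∈α , n∈β)))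
  ...   | inj₂ n∈Y = ∈-++⁺ʳ (selectᶜ bs M) n∈Y
  lengths : length α ≡ length (X ++ select bs M) × length β ≡ length (selectᶜ bs M ++ Y)
  lengths = +≡+-≤⇒≡ (Unique-⊆⇒length≤ α-unique α⊆) (Unique-⊆⇒length≤ β-unique β⊆)
    (trans (sym (length-++ α)) (trans αβ≡XMY (sym (length-select-++ X bs M Y (length-map _ M)))))

PermutationOf-join : ∀ {X M Y bs α β} → Unique (X ++ M ++ Y) → length bs ≡ length M →
  PermutationOf (X ++ select bs M) α → PermutationOf (selectᶜ bs M ++ Y) β →
  PermutationOf (X ++ M ++ Y) (α ++ β) × X ⊆ α × Y ⊆ β × mask α M ≡ bs
PermutationOf-join {X} {M} {Y} {bs} {α} {β} XMY-unique bs≡M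
  α↭@(α≡ , α⊆ , α-unique) β↭@(β≡ , β⊆ , β-unique) =
  (αβ≡XMY , αβ⊆XMY , αβ-unique) , X⊆α , Y⊆β ,
  mask-select bs M bs≡M (λ n∈ → ⊇α (∈-++⁺ʳ X n∈)) (λ (n∈ᶜ , n∈α) → parts-disjoint (α⊆ n∈α , ∈-++⁺ˡ n∈ᶜ))
  where
  ⊇α : X ++ select bs M ⊆ α
  ⊇α = PermutationOf⇒⊇ α↭
  ⊇β : selectᶜ bs M ++ Y ⊆ β
  ⊇β = PermutationOf⇒⊇ β↭
  parts-disjoint : Disjoint (X ++ select bs M) (selectᶜ bs M ++ Y)
  parts-disjoint = select-++-disjoint {X = X} {M = M} {Y = Y} bs XMY-unique
  X⊆α : X ⊆ α
  X⊆α n∈X = ⊇α (∈-++⁺ˡ n∈X)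
  Y⊆β : Y ⊆ β
  Y⊆β n∈Y = ⊇β (∈-++⁺ʳ (selectᶜ bs M) n∈Y)
  αβ-unique : Unique (α ++ β)
  αβ-unique = Uniqueₚ.++⁺ α-unique β-unique (λ (n∈α , n∈β) → parts-disjoint (α⊆ n∈α , β⊆ n∈β))
  αβ⊆XMY : α ++ β ⊆ X ++ M ++ Y
  αβ⊆XMY n∈αβ with ∈-++⁻ α n∈αβ
  ... | inj₁ n∈α with ∈-++⁻ X (α⊆ n∈α)
  ...   | inj₁ n∈X = ∈-++⁺ˡ n∈X
  ...   | inj₂ n∈M = ∈-++⁺ʳ X (∈-++⁺ˡ (select-⊆ bs M n∈M))
  αβ⊆XMY n∈αβ | inj₂ n∈β with ∈-++⁻ (selectᶜ bs M) (β⊆ n∈β)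
  ...   | inj₁ n∈M = ∈-++⁺ʳ X (∈-++⁺ˡ (select-⊆ (map not bs) M n∈M))
  ...   | inj₂ n∈Y = ∈-++⁺ʳ X (∈-++⁺ʳ M n∈Y)
  αβ≡XMY : length (α ++ β) ≡ length (X ++ M ++ Y)
  αβ≡XMY = trans (length-++ α) (trans (cong₂ _+_ α≡ β≡) (length-select-++ X bs M Y bs≡M))

Shuffle : ℕ → ℕ → Set
Shuffle a b = Σ (List Bool) λ bs → trues bs ≡ a × falses bs ≡ b

Shuffle-irrelevant : ∀ {a b} bs → Irrelevant (trues bs ≡ a × falses bs ≡ b)
Shuffle-irrelevant _ = ×-irrelevant ≡-irrelevant ≡-irrelevant

Shuffle-≡ : ∀ {a b} {s s′ : Shuffle a b} → proj₁ s ≡ proj₁ s′ → s ≡ s′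
Shuffle-≡ = Σ-≡-irrelevant λ {bs} → Shuffle-irrelevant bs

module _ {a b} (M : List A) (M≡a+b : length M ≡ a + b) where

  length-Shuffle : ((bs , _) : Shuffle a b) → length bs ≡ length M
  length-Shuffle (bs , trues≡a , falses≡b) =
    trans (sym (trues+falses bs)) (trans (cong₂ _+_ trues≡a falses≡b) (sym M≡a+b))

  length-select-Shuffle : ((bs , _) : Shuffle a b) → length (select bs M) ≡ a
  length-select-Shuffle s@(bs , trues≡a , _) = trans (length-select bs M (length-Shuffle s)) trues≡a

  length-selectᶜ-Shuffle : ((bs , _) : Shuffle a b) → length (selectᶜ bs M) ≡ b
  length-selectᶜ-Shuffle s@(bs , _ , falses≡b) = trans (length-selectᶜ bs M (length-Shuffle s)) falses≡b

module _ {P : List Bool → Set} {Q R : List Bool → List ℕ → Set}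
         (P-irr : ∀ {bs} → Irrelevant (P bs))
         (Q-irr : ∀ {bs α} → Irrelevant (Q bs α)) (R-irr : ∀ {bs β} → Irrelevant (R bs β)) where

  Σ-split-≡ : ∀ {bs bs′ p p′ α α′ q q′ β β′ r r′} → bs ≡ bs′ → α ≡ α′ → β ≡ β′ →
    _≡_ {A = Σ (Σ (List Bool) P) λ s → Σ (List ℕ) (Q (proj₁ s)) × Σ (List ℕ) (R (proj₁ s))}
      ((bs , p) , (α , q) , (β , r)) ((bs′ , p′) , (α′ , q′) , (β′ , r′))
  Σ-split-≡ {p = p} {p′} {q = q} {q′} {r = r} {r′} refl refl refl
    rewrite P-irr p p′ | Q-irr q q′ | R-irr r r′ = refl

-- Decreasing trees

leaves≡suc-size : ∀ τ → leaves τ ≡ suc (size (internal τ))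
leaves≡suc-size leaf = refl
leaves≡suc-size (node l r) = trans (cong₂ _+_ (leaves≡suc-size l) (leaves≡suc-size r)) (cong suc (+-suc _ _))

2≤leaves-node : ∀ l r → 2 ≤ leaves (node l r)
2≤leaves-node l r rewrite leaves≡suc-size l | leaves≡suc-size r = s≤s (≤-trans (s≤s z≤n) (m≤n+m _ _))

_≟ᴮᵀ_ : DecidableEquality BT
empty ≟ᴮᵀ empty = yes refl
empty ≟ᴮᵀ node _ _ = no λ ()
node _ _ ≟ᴮᵀ empty = no λ ()
node l r ≟ᴮᵀ node l′ r′ with l ≟ᴮᵀ l′ | r ≟ᴮᵀ r′
... | yes refl | yes refl = yes refl
... | no l≢l′  | _        = no λ { refl → l≢l′ refl }
... | yes _    | no r≢r′  = no λ { refl → r≢r′ refl }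

BT-≡-irrelevant : {s t : BT} → Irrelevant (s ≡ t)
BT-≡-irrelevant = Decidable⇒UIP.≡-irrelevant _≟ᴮᵀ_

T×T-irrelevant : ∀ {b c} → Irrelevant (T b × T c)
T×T-irrelevant = ×-irrelevant T-irrelevant T-irrelevant

T×≡-irrelevant : ∀ {b} {s t : BT} → Irrelevant (T b × s ≡ t)
T×≡-irrelevant = ×-irrelevant T-irrelevant BT-≡-irrelevant

node-injective : ∀ {l r l′ r′} → BT.node l r ≡ node l′ r′ → l ≡ l′ × r ≡ r′
node-injective refl = refl , refl

-- This is the prefix u of DTfuel up to the maximum m, definitionally.
before : ℕ → List ℕ → List ℕ
before m = takeWhile (λ n → ¬? (n ≟ m))

after : ℕ → List ℕ → List ℕ
after m w = drop (suc (length (before m w))) w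

before-∷-after : ∀ {m w} → m ∈ w → before m w ++ m ∷ after m w ≡ w
before-∷-after {m} {n ∷ ns} m∈w with n ≡ᵇ m in n≡ᵇm
... | true = cong (_∷ ns) (sym (≡ᵇ⇒≡ n m (subst T (sym n≡ᵇm) _)))
before-∷-after {m} {n ∷ ns} (here refl) | false = contradiction (≡⇒≡ᵇ m m refl) (subst T n≡ᵇm)
before-∷-after {m} {n ∷ ns} (there m∈ns) | false = cong (n ∷_) (before-∷-after m∈ns)

before-++-∷ : ∀ {m} u v → m ∉ u → before m (u ++ m ∷ v) ≡ u
before-++-∷ {m} [] v _ with m ≡ᵇ m in m≡ᵇm
... | true = refl
... | false = contradiction (≡⇒≡ᵇ m m refl) (subst T m≡ᵇm)
before-++-∷ {m} (n ∷ u) v m∉u with n ≡ᵇ m in n≡ᵇm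
... | true = contradiction (here (sym (≡ᵇ⇒≡ n m (subst T (sym n≡ᵇm) _)))) m∉u
... | false = cong (n ∷_) (before-++-∷ u v (λ m∈u → m∉u (there m∈u)))

after-++-∷ : ∀ {m} u v → m ∉ u → after m (u ++ m ∷ v) ≡ v
after-++-∷ {m} u v m∉u =
  trans (cong (λ b → drop (suc (length b)) (u ++ m ∷ v)) (before-++-∷ u v m∉u)) (drop-suc-length u m v)

length-before-after : ∀ {m w} → m ∈ w → length w ≡ suc (length (before m w) + length (after m w))
length-before-after {m} {w} m∈w = begin
  length w                                          ≡⟨ cong length (sym (before-∷-after m∈w)) ⟩
  length (before m w ++ m ∷ after m w)              ≡⟨ length-++ (before m w) ⟩
  length (before m w) + suc (length (after m w))    ≡⟨ +-suc _ _ ⟩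
  suc (length (before m w) + length (after m w))    ∎
  where open ≡-Reasoning

module _ (n : ℕ) (ns : List ℕ) where
  private
    m = maxL (n ∷ ns)
    ns≡parts : length ns ≡ length (before m (n ∷ ns)) + length (after m (n ∷ ns))
    ns≡parts = suc-injective (length-before-after (maxL-∈ n ns))

  length-before-maxL≤ : length (before m (n ∷ ns)) ≤ length ns
  length-before-maxL≤ = ≤-trans (m≤m+n _ _) (≤-reflexive (sym ns≡parts))

  length-after-maxL≤ : length (after m (n ∷ ns)) ≤ length ns
  length-after-maxL≤ = ≤-trans (m≤n+m _ _) (≤-reflexive (sym ns≡parts))

DTfuel-[] : ∀ f → DTfuel f [] ≡ lempty
DTfuel-[] zero = refl
DTfuel-[] (suc f) = refl

DTfuel-fuel-irrelevant : ∀ f g w → length w ≤ f → length w ≤ g → DTfuel f w ≡ DTfuel g w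
DTfuel-fuel-irrelevant f g [] _ _ = trans (DTfuel-[] f) (sym (DTfuel-[] g))
DTfuel-fuel-irrelevant (suc f) (suc g) (n ∷ ns) (s≤s ns≤f) (s≤s ns≤g) =
  cong₂ (λ L R → lnode L (maxL (n ∷ ns)) R)
    (DTfuel-fuel-irrelevant f g _ (≤-trans (length-before-maxL≤ n ns) ns≤f) (≤-trans (length-before-maxL≤ n ns) ns≤g))
    (DTfuel-fuel-irrelevant f g _ (≤-trans (length-after-maxL≤ n ns) ns≤f) (≤-trans (length-after-maxL≤ n ns) ns≤g))

size-DTfuel : ∀ f w → length w ≤ f → size (shape (DTfuel f w)) ≡ length w
size-DTfuel f [] _ = cong (size ∘ shape) (DTfuel-[] f)
size-DTfuel (suc f) (n ∷ ns) (s≤s ns≤f) =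
  trans (cong suc (cong₂ _+_ (size-DTfuel f _ (≤-trans (length-before-maxL≤ n ns) ns≤f))
                             (size-DTfuel f _ (≤-trans (length-after-maxL≤ n ns) ns≤f))))
        (sym (length-before-after (maxL-∈ n ns)))

size-shape-DT : ∀ w → size (shape (DT w)) ≡ length w
size-shape-DT w = size-DTfuel (length w) w ≤-refl

shape-DT : ∀ {m w} → m ∈ w → maxL w ≡ m →
  shape (DT w) ≡ node (shape (DT (before m w))) (shape (DT (after m w)))
shape-DT {w = n ∷ ns} _ refl = cong₂ (λ L R → node (shape L) (shape R))
  (DTfuel-fuel-irrelevant _ _ _ (length-before-maxL≤ n ns) ≤-refl) (DTfuel-fuel-irrelevant _ _ _ (length-after-maxL≤ n ns) ≤-refl)

shape-DT-++-∷ : ∀ {m} u v → m ∉ u → maxL (u ++ m ∷ v) ≡ m →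
  shape (DT (u ++ m ∷ v)) ≡ node (shape (DT u)) (shape (DT v))
shape-DT-++-∷ {m} u v m∉u max≡m =
  trans (shape-DT (∈-++⁺ʳ u (here refl)) max≡m)
        (cong₂ (λ L R → node (shape (DT L)) (shape (DT R))) (before-++-∷ u v m∉u) (after-++-∷ u v m∉u))

-- Removing the root

AdmissibleOn : List ℕ → FBT → Set
AdmissibleOn S τ = Σ (List ℕ) λ σ → T (permutationOfᵇ S σ) × T (admissibleᵇ τ σ)

T-admissibleᵇ-node⇔ : ∀ {l r σ} → let α = take (leaves l) σ; β = drop (leaves l) σ in
  T (admissibleᵇ (node l r) σ) ⇔ (minL σ ∈ α × maxL σ ∈ β × T (admissibleᵇ l α) × T (admissibleᵇ r β))
T-admissibleᵇ-node⇔ = mk⇔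
  (λ p → let min∈α , p₁ = Equivalence.to T-∧ p; max∈β , p₂ = Equivalence.to T-∧ p₁ in
    Equivalence.to T-elemᵇ⇔∈ min∈α , Equivalence.to T-elemᵇ⇔∈ max∈β , Equivalence.to T-∧ p₂)
  (λ (min∈α , max∈β , adm) → Equivalence.from T-∧ (Equivalence.from T-elemᵇ⇔∈ min∈α ,
    Equivalence.from T-∧ (Equivalence.from T-elemᵇ⇔∈ max∈β , Equivalence.from T-∧ adm)))

module AdmissibleNode {h : ℕ} {M : List ℕ} {z : ℕ} {l r : FBT}
  (inc : Increasing (h ∷ M ∷ʳ z)) (len : length (h ∷ M ∷ʳ z) ≡ leaves l + leaves r) where

  private
    S : List ℕ
    S = h ∷ M ∷ʳ z
    a b : ℕ
    a = size (internal l)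
    b = size (internal r)

  length-M : length M ≡ a + b
  length-M = suc-injective (suc-injective (begin
    suc (suc (length M))   ≡⟨ cong suc (sym (length-∷ʳ M z)) ⟩
    length S               ≡⟨ len ⟩
    leaves l + leaves r    ≡⟨ cong₂ _+_ (leaves≡suc-size l) (leaves≡suc-size r) ⟩
    suc a + suc b          ≡⟨ cong suc (+-suc a b) ⟩
    suc (suc (a + b))      ∎))
    where open ≡-Reasoning

  length-left : ((bs , _) : Shuffle a b) → length (h ∷ select bs M) ≡ leaves l
  length-left s = trans (cong suc (length-select-Shuffle M length-M s)) (sym (leaves≡suc-size l))

  length-right : ((bs , _) : Shuffle a b) → length (selectᶜ bs M ∷ʳ z) ≡ leaves r
  length-right s@(bs , _) =
    trans (length-∷ʳ (selectᶜ bs M) z) (trans (cong suc (length-selectᶜ-Shuffle M length-M s)) (sym (leaves≡suc-size r)))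

  increasing-left : ∀ bs → Increasing (h ∷ select bs M)
  increasing-left bs = AllPairs-select (true ∷ bs) (proj₁ (Increasing-∷ʳ⁻ {ns = h ∷ M} inc))

  increasing-right : ∀ bs → Increasing (selectᶜ bs M ∷ʳ z)
  increasing-right bs = Increasing-select-∷ʳ (map not bs) (AllPairs.tail inc)

  minL≡h : ∀ {σ} → PermutationOf S σ → minL σ ≡ h
  minL≡h σ↭S = minL-PermutationOf σ↭S (here refl) (Increasing⇒head≤ inc)

  maxL≡z : ∀ {σ} → PermutationOf S σ → maxL σ ≡ z
  maxL≡z σ↭S = maxL-PermutationOf σ↭S (∈-++⁺ʳ (h ∷ M) (here refl)) (Increasing⇒≤last {ns = h ∷ M} inc)

  Split : Set
  Split = Σ (Shuffle a b) λ (bs , _) → AdmissibleOn (h ∷ select bs M) l × AdmissibleOn (selectᶜ bs M ∷ʳ z) r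

  split : AdmissibleOn S (node l r) → Split
  split (σ , σ-perm , σ-adm) =
    (bs , counts) , (α , Equivalence.from T-permutationOfᵇ⇔ α↭ , adm-l) , (β , Equivalence.from T-permutationOfᵇ⇔ β↭ , adm-r)
    where
    σ↭S = Equivalence.to T-permutationOfᵇ⇔ σ-perm
    α = take (leaves l) σ
    β = drop (leaves l) σ
    bs = mask α M
    root = Equivalence.to (T-admissibleᵇ-node⇔ {l} {r} {σ}) σ-adm
    adm-l = proj₁ (proj₂ (proj₂ root))
    adm-r = proj₂ (proj₂ (proj₂ root))
    h∈α = subst (_∈ α) (minL≡h σ↭S) (proj₁ root)
    z∈β = subst (_∈ β) (maxL≡z σ↭S) (proj₁ (proj₂ root))
    σ≡ : length σ ≡ leaves l + leaves r
    σ≡ = trans (proj₁ σ↭S) len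
    parts = PermutationOf-split {X = [ h ]} {M} {[ z ]} (subst (PermutationOf S) (sym (take++drop≡id (leaves l) σ)) σ↭S)
              (λ { (here refl) → h∈α }) (λ { (here refl) → z∈β })
    α↭ = proj₁ parts
    β↭ = proj₂ parts
    counts = select-lengths⇒counts bs M (length-map _ M)
      (suc-injective (trans (sym (proj₁ α↭)) (trans (length-take-+ (leaves l) σ σ≡) (leaves≡suc-size l))))
      (suc-injective (trans (sym (length-∷ʳ (selectᶜ bs M) z)) (trans (sym (proj₁ β↭)) (trans (length-drop-+ (leaves l) σ σ≡) (leaves≡suc-size r)))))

  module Join (bs : List Bool) (trues≡a : trues bs ≡ a) (falses≡b : falses bs ≡ b)
              (α : List ℕ) (p : T (permutationOfᵇ (h ∷ select bs M) α) × T (admissibleᵇ l α))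
              (β : List ℕ) (q : T (permutationOfᵇ (selectᶜ bs M ∷ʳ z) β) × T (admissibleᵇ r β)) where

    private
      α↭ : PermutationOf (h ∷ select bs M) α
      α↭ = Equivalence.to T-permutationOfᵇ⇔ (proj₁ p)
      β↭ : PermutationOf (selectᶜ bs M ∷ʳ z) β
      β↭ = Equivalence.to T-permutationOfᵇ⇔ (proj₁ q)
      joined = PermutationOf-join {X = [ h ]} {M} {[ z ]} (Increasing⇒Unique inc)
                 (length-Shuffle M length-M (bs , trues≡a , falses≡b)) α↭ β↭
      α≡l : length α ≡ leaves l
      α≡l = trans (proj₁ α↭) (length-left (bs , trues≡a , falses≡b))

    take≡α : take (leaves l) (α ++ β) ≡ α
    take≡α = take-length-++ (leaves l) α β α≡l

    drop≡β : drop (leaves l) (α ++ β) ≡ β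
    drop≡β = drop-length-++ (leaves l) α β α≡l

    mask≡bs : mask (take (leaves l) (α ++ β)) M ≡ bs
    mask≡bs = trans (cong (λ α′ → mask α′ M) take≡α) (proj₂ (proj₂ (proj₂ joined)))

    admissible : T (permutationOfᵇ S (α ++ β)) × T (admissibleᵇ (node l r) (α ++ β))
    admissible = Equivalence.from T-permutationOfᵇ⇔ αβ↭ ,
      Equivalence.from (T-admissibleᵇ-node⇔ {l} {r} {α ++ β})
        (subst₂ _∈_ (sym (minL≡h αβ↭)) (sym take≡α) (proj₁ (proj₂ joined) (here refl)) ,
         subst₂ _∈_ (sym (maxL≡z αβ↭)) (sym drop≡β) (proj₁ (proj₂ (proj₂ joined)) (here refl)) ,
         subst (T ∘ admissibleᵇ l) (sym take≡α) (proj₂ p) ,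
         subst (T ∘ admissibleᵇ r) (sym drop≡β) (proj₂ q))
      where αβ↭ = proj₁ joined

  join : Split → AdmissibleOn S (node l r)
  join ((bs , trues≡a , falses≡b) , (α , p) , (β , q)) = α ++ β , admissible
    where open Join bs trues≡a falses≡b α p β q

  split↔ : AdmissibleOn S (node l r) ↔ Split
  split↔ = mk↔ₛ′ split join split-join join-split
    where
    join-split : ∀ x → join (split x) ≡ x
    join-split (σ , _) = Σ-≡-irrelevant T×T-irrelevant (take++drop≡id (leaves l) σ)
    split-join : ∀ y → split (join y) ≡ y
    split-join ((bs , trues≡a , falses≡b) , (α , p) , (β , q)) =
      Σ-split-≡ (λ {bs} → Shuffle-irrelevant bs) T×T-irrelevant T×T-irrelevant mask≡bs take≡α drop≡β
      where open Join bs trues≡a falses≡b α p β q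

DecreasingOn : List ℕ → BT → Set
DecreasingOn S t = Σ (List ℕ) λ w → T (permutationOfᵇ S w) × shape (DT w) ≡ t

module DecreasingNode {M : List ℕ} {z : ℕ} {l r : BT}
  (inc : Increasing (M ∷ʳ z)) (len : length (M ∷ʳ z) ≡ size (node l r)) where

  private
    S : List ℕ
    S = M ∷ʳ z

  length-M : length M ≡ size l + size r
  length-M = suc-injective (trans (sym (length-∷ʳ M z)) len)

  increasing-left : ∀ bs → Increasing (select bs M)
  increasing-left bs = AllPairs-select bs (proj₁ (Increasing-∷ʳ⁻ inc))

  increasing-right : ∀ bs → Increasing (selectᶜ bs M)
  increasing-right bs = AllPairs-select (map not bs) (proj₁ (Increasing-∷ʳ⁻ inc))

  z∉M : z ∉ M
  z∉M z∈M = <-irrefl refl (All.lookup (proj₂ (Increasing-∷ʳ⁻ inc)) z∈M)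

  z∈ : ∀ {w} → PermutationOf S w → z ∈ w
  z∈ w↭S = PermutationOf⇒⊇ w↭S (∈-++⁺ʳ M (here refl))

  maxL≡z : ∀ {w} → PermutationOf S w → maxL w ≡ z
  maxL≡z w↭S = maxL-PermutationOf w↭S (∈-++⁺ʳ M (here refl)) (Increasing⇒≤last inc)

  Split : Set
  Split = Σ (Shuffle (size l) (size r)) λ (bs , _) → DecreasingOn (select bs M) l × DecreasingOn (selectᶜ bs M) r

  split : DecreasingOn S (node l r) → Split
  split (w , p , shape≡) = (bs , counts) ,
    (u , Equivalence.from T-permutationOfᵇ⇔ u↭ , shape-u) , (v , Equivalence.from T-permutationOfᵇ⇔ v↭ , shape-v)
    where
    w↭S : PermutationOf S w
    w↭S = Equivalence.to T-permutationOfᵇ⇔ p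
    u = before z w
    v = after z w
    bs = mask u M
    parts = PermutationOf-split {X = []} {M} {[ z ]} {u} {z ∷ v}
              (subst (PermutationOf S) (sym (before-∷-after (z∈ w↭S))) w↭S) (λ ()) (λ { (here refl) → here refl })
    u↭ : PermutationOf (select bs M) u
    u↭ = proj₁ parts
    v↭ : PermutationOf (selectᶜ bs M) v
    v↭ = PermutationOf-∷ʳ-∷⁻ (proj₂ parts)
    shapes = node-injective (trans (sym (shape-DT (z∈ w↭S) (maxL≡z w↭S))) shape≡)
    shape-u = proj₁ shapes
    shape-v = proj₂ shapes
    counts = select-lengths⇒counts bs M (length-map _ M)
      (trans (sym (proj₁ u↭)) (trans (sym (size-shape-DT u)) (cong size shape-u)))
      (trans (sym (proj₁ v↭)) (trans (sym (size-shape-DT v)) (cong size shape-v)))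

  module Join (bs : List Bool) (trues≡l : trues bs ≡ size l) (falses≡r : falses bs ≡ size r)
              (u : List ℕ) (p : T (permutationOfᵇ (select bs M) u))
              (v : List ℕ) (q : T (permutationOfᵇ (selectᶜ bs M) v)) where

    private
      u↭ : PermutationOf (select bs M) u
      u↭ = Equivalence.to T-permutationOfᵇ⇔ p
      v↭ : PermutationOf (selectᶜ bs M) v
      v↭ = Equivalence.to T-permutationOfᵇ⇔ q
      joined = PermutationOf-join {X = []} {M} {[ z ]} (Increasing⇒Unique inc)
                 (length-Shuffle M length-M (bs , trues≡l , falses≡r)) u↭
                 (PermutationOf-∷ʳ-∷⁺ (λ z∈ → z∉M (select-⊆ (map not bs) M z∈)) v↭)

    z∉u : z ∉ u
    z∉u z∈u = z∉M (select-⊆ bs M (proj₁ (proj₂ u↭) z∈u))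

    uzv↭S : PermutationOf S (u ++ z ∷ v)
    uzv↭S = proj₁ joined

    mask≡bs : mask (before z (u ++ z ∷ v)) M ≡ bs
    mask≡bs = trans (cong (λ u′ → mask u′ M) (before-++-∷ u v z∉u)) (proj₂ (proj₂ (proj₂ joined)))

  join : Split → DecreasingOn S (node l r)
  join ((bs , trues≡l , falses≡r) , (u , p , shape-u) , (v , q , shape-v)) =
    u ++ z ∷ v , Equivalence.from T-permutationOfᵇ⇔ uzv↭S ,
    trans (shape-DT-++-∷ u v z∉u (maxL≡z uzv↭S)) (cong₂ node shape-u shape-v)
    where open Join bs trues≡l falses≡r u p v q

  split↔ : DecreasingOn S (node l r) ↔ Split
  split↔ = mk↔ₛ′ split join split-join join-split
    where
    join-split : ∀ x → join (split x) ≡ x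
    join-split (w , p , _) = Σ-≡-irrelevant T×≡-irrelevant
      (before-∷-after (z∈ (Equivalence.to T-permutationOfᵇ⇔ p)))
    split-join : ∀ y → split (join y) ≡ y
    split-join ((bs , trues≡l , falses≡r) , (u , p , _) , (v , q , _)) =
      Σ-split-≡ (λ {bs} → Shuffle-irrelevant bs) T×≡-irrelevant
        T×≡-irrelevant mask≡bs (before-++-∷ u v z∉u) (after-++-∷ u v z∉u)
      where open Join bs trues≡l falses≡r u p v q

TreeShuffle : BT → Set
TreeShuffle empty      = ⊤
TreeShuffle (node l r) = Shuffle (size l) (size r) × (TreeShuffle l × TreeShuffle r)

AdmissibleOn-singleton↔⊤ : ∀ x → AdmissibleOn [ x ] leaf ↔ ⊤
AdmissibleOn-singleton↔⊤ x = mk↔ₛ′ (λ _ → tt) (λ _ → [ x ] , x↭x , tt) (λ _ → refl)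
  (λ (σ , p , _) → Σ-≡-irrelevant T×T-irrelevant (sym (PermutationOf-singleton (Equivalence.to T-permutationOfᵇ⇔ p))))
  where
  x↭x : T (permutationOfᵇ [ x ] [ x ])
  x↭x = Equivalence.from (T-permutationOfᵇ⇔ {[ x ]}) (refl , (λ x∈ → x∈) , [] ∷ [])

DecreasingOn-[]↔⊤ : DecreasingOn [] empty ↔ ⊤
DecreasingOn-[]↔⊤ = mk↔ₛ′ (λ _ → tt) (λ _ → [] , tt , refl) (λ _ → refl)
  (λ (w , p , _) → Σ-≡-irrelevant T×≡-irrelevant
    (sym (PermutationOf-[] (Equivalence.to T-permutationOfᵇ⇔ p))))

AdmissibleOn↔TreeShuffle : ∀ τ {S} → Increasing S → length S ≡ leaves τ → AdmissibleOn S τ ↔ TreeShuffle (internal τ)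
AdmissibleOn↔TreeShuffle leaf {x ∷ []} _ _ = AdmissibleOn-singleton↔⊤ x
AdmissibleOn↔TreeShuffle (node l r) {[]} _ len = contradiction (subst (2 ≤_) (sym len) (2≤leaves-node l r)) λ ()
AdmissibleOn↔TreeShuffle (node l r) {h ∷ S} inc len with initLast S
... | [] = contradiction (subst (2 ≤_) (sym len) (2≤leaves-node l r)) λ { (s≤s ()) }
... | M ∷ʳ′ z = ↔-trans split↔ (Σ-↔ ↔-refl λ {s} →
        AdmissibleOn↔TreeShuffle l (increasing-left (proj₁ s)) (length-left s)
        ×-↔ AdmissibleOn↔TreeShuffle r (increasing-right (proj₁ s)) (length-right s))
  where open AdmissibleNode {l = l} {r} inc len

DecreasingOn↔TreeShuffle : ∀ t {S} → Increasing S → length S ≡ size t → DecreasingOn S t ↔ TreeShuffle t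
DecreasingOn↔TreeShuffle empty {[]} _ _ = DecreasingOn-[]↔⊤
DecreasingOn↔TreeShuffle (node l r) {S} inc len with initLast S
... | M ∷ʳ′ z = ↔-trans split↔ (Σ-↔ ↔-refl λ {s} →
        DecreasingOn↔TreeShuffle l (increasing-left (proj₁ s)) (length-select-Shuffle M length-M s)
        ×-↔ DecreasingOn↔TreeShuffle r (increasing-right (proj₁ s)) (length-selectᶜ-Shuffle M length-M s))
  where open DecreasingNode {l = l} {r} inc len

-- Counting

Shuffle-0-0↔⊤ : Shuffle 0 0 ↔ ⊤
Shuffle-0-0↔⊤ = mk↔ₛ′ (λ _ → tt) (λ _ → [] , refl , refl) (λ _ → refl) empty-only
  where
  empty-only : ∀ s → ([] , refl , refl) ≡ s
  empty-only ([] , refl , refl) = refl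
  empty-only (true ∷ _ , () , _)
  empty-only (false ∷ _ , _ , ())

Shuffle-0-suc↔ : ∀ {b} → Shuffle 0 (suc b) ↔ Shuffle 0 b
Shuffle-0-suc↔ = mk↔ₛ′ tail (λ (bs , t , f) → false ∷ bs , t , cong suc f)
  (λ _ → Shuffle-≡ refl) (λ { (false ∷ _ , _) → Shuffle-≡ refl })
  where
  tail : ∀ {b} → Shuffle 0 (suc b) → Shuffle 0 b
  tail (false ∷ bs , t , f) = bs , t , suc-injective f

Shuffle-suc-0↔ : ∀ {a} → Shuffle (suc a) 0 ↔ Shuffle a 0
Shuffle-suc-0↔ = mk↔ₛ′ tail (λ (bs , t , f) → true ∷ bs , cong suc t , f)
  (λ _ → Shuffle-≡ refl) (λ { (true ∷ _ , _) → Shuffle-≡ refl })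
  where
  tail : ∀ {a} → Shuffle (suc a) 0 → Shuffle a 0
  tail (true ∷ bs , t , f) = bs , suc-injective t , f

Shuffle-suc-suc↔ : ∀ {a b} → Shuffle (suc a) (suc b) ↔ (Shuffle a (suc b) ⊎ Shuffle (suc a) b)
Shuffle-suc-suc↔ = mk↔ₛ′ uncons cons
  (λ { (inj₁ _) → cong inj₁ (Shuffle-≡ refl) ; (inj₂ _) → cong inj₂ (Shuffle-≡ refl) })
  (λ { (true ∷ _ , _) → Shuffle-≡ refl ; (false ∷ _ , _) → Shuffle-≡ refl })
  where
  uncons : ∀ {a b} → Shuffle (suc a) (suc b) → Shuffle a (suc b) ⊎ Shuffle (suc a) b
  uncons (true ∷ bs , t , f)  = inj₁ (bs , suc-injective t , f)
  uncons (false ∷ bs , t , f) = inj₂ (bs , t , suc-injective f)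
  cons : ∀ {a b} → Shuffle a (suc b) ⊎ Shuffle (suc a) b → Shuffle (suc a) (suc b)
  cons (inj₁ (bs , t , f)) = true ∷ bs , cong suc t , f
  cons (inj₂ (bs , t , f)) = false ∷ bs , t , cong suc f

Shuffle-0ˡ↔⊤ : ∀ b → Shuffle 0 b ↔ ⊤
Shuffle-0ˡ↔⊤ zero    = Shuffle-0-0↔⊤
Shuffle-0ˡ↔⊤ (suc b) = ↔-trans Shuffle-0-suc↔ (Shuffle-0ˡ↔⊤ b)

Shuffle-0ʳ↔⊤ : ∀ a → Shuffle a 0 ↔ ⊤
Shuffle-0ʳ↔⊤ zero    = Shuffle-0-0↔⊤
Shuffle-0ʳ↔⊤ (suc a) = ↔-trans Shuffle-suc-0↔ (Shuffle-0ʳ↔⊤ a)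

shuffleCount : ℕ → ℕ → ℕ
shuffleCount zero    _       = 1
shuffleCount (suc a) zero    = 1
shuffleCount (suc a) (suc b) = shuffleCount a (suc b) + shuffleCount (suc a) b

Shuffle↔Fin : ∀ a b → Shuffle a b ↔ Fin (shuffleCount a b)
Shuffle↔Fin zero    b       = ↔-trans (Shuffle-0ˡ↔⊤ b) (↔-sym 1↔⊤)
Shuffle↔Fin (suc a) zero    = ↔-trans (Shuffle-0ʳ↔⊤ (suc a)) (↔-sym 1↔⊤)
Shuffle↔Fin (suc a) (suc b) =
  ↔-trans Shuffle-suc-suc↔ (↔-trans (Shuffle↔Fin a (suc b) ⊎-↔ Shuffle↔Fin (suc a) b) (↔-sym +↔⊎))

shuffleCount-! : ∀ a b → shuffleCount a b * (a ! * b !) ≡ (a + b) !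
shuffleCount-! zero b = trans (+-identityʳ _) (*-identityˡ _)
shuffleCount-! (suc a) zero = trans (+-identityʳ _) (trans (*-identityʳ _) (cong _! (sym (+-identityʳ (suc a)))))
shuffleCount-! (suc a) (suc b) = begin
  (Cₗ + Cᵣ) * ((suc a * a !) * (suc b * b !))
    ≡⟨ distribute a b Cₗ Cᵣ (a !) (b !) ⟩
  suc a * (Cₗ * (a ! * (suc b * b !))) + suc b * (Cᵣ * ((suc a * a !) * b !))
    ≡⟨ cong₂ (λ x y → suc a * x + suc b * y) (shuffleCount-! a (suc b)) (shuffleCount-! (suc a) b) ⟩
  suc a * (a + suc b) ! + suc b * (suc a + b) !
    ≡⟨ cong (λ k → suc a * k ! + suc b * (suc a + b) !) (+-suc a b) ⟩
  suc a * (suc (a + b)) ! + suc b * (suc (a + b)) !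
    ≡⟨ collect a b ((suc (a + b)) !) ⟩
  suc (suc (a + b)) * (suc (a + b)) !
    ≡⟨ cong (λ k → suc k * k !) (sym (+-suc a b)) ⟩
  (suc a + suc b) ! ∎
  where
  open ≡-Reasoning
  Cₗ = shuffleCount a (suc b)
  Cᵣ = shuffleCount (suc a) b
  distribute : ∀ a b x y fa fb → (x + y) * ((suc a * fa) * (suc b * fb)) ≡
                                 suc a * (x * (fa * (suc b * fb))) + suc b * (y * ((suc a * fa) * fb))
  distribute = solve-∀
  collect : ∀ a b F → suc a * F + suc b * F ≡ suc (suc (a + b)) * F
  collect = solve-∀

treeShuffleCount : BT → ℕ
treeShuffleCount empty      = 1
treeShuffleCount (node l r) = shuffleCount (size l) (size r) * (treeShuffleCount l * treeShuffleCount r)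

TreeShuffle↔Fin : ∀ t → TreeShuffle t ↔ Fin (treeShuffleCount t)
TreeShuffle↔Fin empty      = ↔-sym 1↔⊤
TreeShuffle↔Fin (node l r) =
  ↔-trans (Shuffle↔Fin _ _ ×-↔ ↔-trans (TreeShuffle↔Fin l ×-↔ TreeShuffle↔Fin r) (↔-sym *↔×)) (↔-sym *↔×)

treeShuffleCount-hookProd : ∀ t → treeShuffleCount t * hookProd t ≡ size t !
treeShuffleCount-hookProd empty = refl
treeShuffleCount-hookProd (node l r) = begin
  (B * (K l * K r)) * (suc n * (hookProd l * hookProd r))
    ≡⟨ regroup B (K l) (K r) (suc n) (hookProd l) (hookProd r) ⟩
  suc n * (B * ((K l * hookProd l) * (K r * hookProd r)))
    ≡⟨ cong₂ (λ x y → suc n * (B * (x * y))) (treeShuffleCount-hookProd l) (treeShuffleCount-hookProd r) ⟩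
  suc n * (B * (size l ! * size r !))
    ≡⟨ cong (suc n *_) (shuffleCount-! (size l) (size r)) ⟩
  suc n * n ! ∎
  where
  open ≡-Reasoning
  K = treeShuffleCount
  B = shuffleCount (size l) (size r)
  n = size l + size r
  regroup : ∀ b kl kr s hl hr → (b * (kl * kr)) * (s * (hl * hr)) ≡ s * (b * ((kl * hl) * (kr * hr)))
  regroup = solve-∀

range : ℕ → List ℕ
range = applyUpTo suc

Increasing-range : ∀ n → Increasing (range n)
Increasing-range n = AllPairsₚ.applyUpTo⁺₁ suc n (λ i<j _ → s≤s i<j)

length-range : ∀ n → length (range n) ≡ n
length-range = length-applyUpTo suc

∈-range⇔ : ∀ {n x} → x ∈ range n ⇔ (1 ≤ x × x ≤ n)
∈-range⇔ = mk⇔ to from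
  where
  to : ∀ {n x} → x ∈ range n → 1 ≤ x × x ≤ n
  to x∈ with ∈-applyUpTo⁻ suc x∈
  ... | _ , i<n , refl = s≤s z≤n , i<n
  from : ∀ {n x} → 1 ≤ x × x ≤ n → x ∈ range n
  from (s≤s z≤n , x<n) = ∈-applyUpTo⁺ suc x<n

elemᵇ-range : ∀ n x → elemᵇ x (range n) ≡ (1 ≤ᵇ x) ∧ (x ≤ᵇ n)
elemᵇ-range n x = T-injective (mk⇔
  (λ t → let 1≤x , x≤n = Equivalence.to ∈-range⇔ (Equivalence.to (T-elemᵇ⇔∈ {x} {range n}) t) in
         Equivalence.from (T-∧ {1 ≤ᵇ x}) (≤⇒≤ᵇ 1≤x , ≤⇒≤ᵇ x≤n))
  (λ t → let 1≤x , x≤n = Equivalence.to (T-∧ {1 ≤ᵇ x}) t in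
         Equivalence.from T-elemᵇ⇔∈ (Equivalence.from ∈-range⇔ (≤ᵇ⇒≤ 1 x 1≤x , ≤ᵇ⇒≤ x n x≤n))))

isPermᵇ≡permutationOfᵇ-range : ∀ n σ → isPermᵇ n σ ≡ permutationOfᵇ (range n) σ
isPermᵇ≡permutationOfᵇ-range n σ = cong₂ _∧_ (cong (length σ ≡ᵇ_) (sym (length-range n)))
  (cong (_∧ distinctᵇ σ) (cong and (map-cong (λ x → sym (elemᵇ-range n x)) σ)))

AdmissibleLabelling↔AdmissibleOn-range : ∀ τ → AdmissibleLabelling τ ↔ AdmissibleOn (range (leaves τ)) τ
AdmissibleLabelling↔AdmissibleOn-range τ = Σ-↔ ↔-refl λ {σ} →
  ⇔⇒↔-irrelevant T-irrelevant T×T-irrelevant (mk⇔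
    (λ p → let perm , adm = Equivalence.to (T-∧ {isPermᵇ (leaves τ) σ}) p in subst T (perm≡ σ) perm , adm)
    (λ (perm , adm) → Equivalence.from T-∧ (subst T (sym (perm≡ σ)) perm , adm)))
  where perm≡ = isPermᵇ≡permutationOfᵇ-range (leaves τ)

DTPerm↔DecreasingOn-range : ∀ m t → DTPerm m t ↔ DecreasingOn (range m) t
DTPerm↔DecreasingOn-range m t = Σ-↔ ↔-refl λ {w} →
  ⇔⇒↔-irrelevant T×≡-irrelevant T×≡-irrelevant
    (mk⇔ (λ (p , e) → subst T (perm≡ w) p , e) (λ (p , e) → subst T (sym (perm≡ w)) p , e))
  where perm≡ = isPermᵇ≡permutationOfᵇ-range m

mainTheorem17 : (τ : FBT) →
    (AdmissibleLabelling τ ↔ DTPerm (leaves τ ∸ 1) (internal τ)) ×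
    Σ ℕ (λ k → (AdmissibleLabelling τ ↔ Fin k) × (k * hookProd (internal τ) ≡ (leaves τ ∸ 1) !))
mainTheorem17 τ =
  ↔-trans admissible↔shuffles (↔-sym decreasing↔shuffles) ,
  treeShuffleCount t , ↔-trans admissible↔shuffles (TreeShuffle↔Fin t) ,
  trans (treeShuffleCount-hookProd t) (cong _! (sym n-1≡size))
  where
  t = internal τ
  n-1≡size : leaves τ ∸ 1 ≡ size t
  n-1≡size = cong (_∸ 1) (leaves≡suc-size τ)
  admissible↔shuffles : AdmissibleLabelling τ ↔ TreeShuffle t
  admissible↔shuffles = ↔-trans (AdmissibleLabelling↔AdmissibleOn-range τ)
    (AdmissibleOn↔TreeShuffle τ (Increasing-range (leaves τ)) (length-range (leaves τ)))
  decreasing↔shuffles : DTPerm (leaves τ ∸ 1) t ↔ TreeShuffle t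
  decreasing↔shuffles = ↔-trans (DTPerm↔DecreasingOn-range (leaves τ ∸ 1) t)
    (DecreasingOn↔TreeShuffle t (Increasing-range (leaves τ ∸ 1)) (trans (length-range (leaves τ ∸ 1)) n-1≡size))
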